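{- For any tree $T$ of order at least three, $\mathrm{mob}(T\,\square\, K_2)=\ell(T)$, where $\ell(T)$ is the number of leaves of $T$.
   Context: A leaf is a vertex of degree one. $\square$ is the Cartesian product: vertex set $V(G)\times V(H)$, $(g,h)\sim(g',h')$ iff ($gg'\in E(G)$, $h=h'$) or ($g=g'$, $hh'\in E(H)$). A set $S\subseteq V(G)$ is a general position set if no three vertices of $S$ lie on a common shortest path. Robots are placed one per vertex of a general position set $S$; a move $u\to v$ along an edge $uv$ with $u\in S$ is legal if $v\notin S$ and $(S\setminus\{u\})\cup\{v\}$ is a general position set. $S$ is a mobile general position set if some sequence of legal moves starting from $S$ visits every vertex at least once; $\mathrm{mob}(G)$ is the maximum size of a mobile general position set. -}

module Defs where

open import Data.Nat using (ℕ; zero; suc; _≤_; _≟_)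
open import Data.Fin using (Fin)
open import Data.Bool using (Bool; true; false)
open import Data.List using (List; []; _∷_; _++_; length; filter; tail)
open import Data.List.Membership.Propositional using (_∈_; _∉_)
open import Data.List.Relation.Unary.Any using (Any)
open import Data.List.Relation.Unary.Unique.Propositional using (Unique)
open import Data.List.Base using (allFin)
open import Data.Product using (Σ; ∃; _×_; _,_)
open import Data.Sum using (_⊎_; inj₁; inj₂)
open import Data.Empty using (⊥)
open import Relation.Binary.PropositionalEquality as Eq using (_≡_; _≢_; refl)
open import Relation.Nullary using (¬_)

record Graph : Set₁ where
  field
    V      : Set
    Adj    : V → V → Set
    adj-sym    : ∀ {x y} → Adj x y → Adj y x
    adj-irrefl : ∀ {x} → ¬ Adj x x
open Graph public

_□_ : Graph → Graph → Graph
G □ H = record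
  { V          = V G × V H
  ; Adj        = A
  ; adj-sym    = s
  ; adj-irrefl = i
  }
  where
  A : V G × V H → V G × V H → Set
  A (g , h) (g' , h') = (Adj G g g' × h ≡ h') ⊎ (g ≡ g' × Adj H h h')
  s : ∀ {x y} → A x y → A y x
  s (inj₁ (a , e)) = inj₁ (adj-sym G a , Eq.sym e)
  s (inj₂ (e , a)) = inj₂ (Eq.sym e , adj-sym H a)
  i : ∀ {x} → ¬ A x x
  i (inj₁ (a , _)) = adj-irrefl G a
  i (inj₂ (_ , a)) = adj-irrefl H a

K₂ : Graph
K₂ = record
  { V = Fin 2 ; Adj = λ i j → i ≢ j
  ; adj-sym = λ ne e → ne (Eq.sym e) ; adj-irrefl = λ ne → ne refl }

module _ (G : Graph) where

  data Walk : V G → V G → Set where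
    [_]    : ∀ x → Walk x x
    _∷⟨_⟩_ : ∀ x {y z} → Adj G x y → Walk y z → Walk x z

  walkLength : ∀ {x y} → Walk x y → ℕ
  walkLength [ _ ]          = 0
  walkLength (_ ∷⟨ _ ⟩ p)   = suc (walkLength p)

  verts : ∀ {x y} → Walk x y → List (V G)
  verts [ x ]          = x ∷ []
  verts (x ∷⟨ _ ⟩ p)   = x ∷ verts p

  IsShortest : ∀ {x y} → Walk x y → Set
  IsShortest {x} {y} p = ∀ (q : Walk x y) → walkLength p ≤ walkLength q

  OnCommonGeodesic : V G → V G → V G → Set
  OnCommonGeodesic u v w =
    Σ (V G) λ x → Σ (V G) λ y → Σ (Walk x y) λ p →
      IsShortest p × u ∈ verts p × v ∈ verts p × w ∈ verts p

  -- general position set (a set of vertices = a duplicate-free list)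
  IsGPSet : List (V G) → Set
  IsGPSet S = Unique S ×
    (∀ u v w → u ∈ S → v ∈ S → w ∈ S →
       u ≢ v → v ≢ w → u ≢ w → ¬ OnCommonGeodesic u v w)

  data LegalMove : List (V G) → List (V G) → Set where
    move : ∀ xs ys u v → Adj G u v → v ∉ (xs ++ u ∷ ys) →
           IsGPSet (xs ++ v ∷ ys) →
           LegalMove (xs ++ u ∷ ys) (xs ++ v ∷ ys)

  data MoveSeq : List (List (V G)) → Set where
    done : ∀ S → MoveSeq (S ∷ [])
    step : ∀ {S S' cs} → LegalMove S S' → MoveSeq (S' ∷ cs) → MoveSeq (S ∷ S' ∷ cs)

  IsMobileGPSet : List (V G) → Set
  IsMobileGPSet S = IsGPSet S ×
    Σ (List (List (V G))) λ cs → MoveSeq (S ∷ cs) ×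
      (∀ v → Any (v ∈_) (S ∷ cs))

  MobIs : ℕ → Set
  MobIs k = (Σ (List (V G)) λ S → IsMobileGPSet S × length S ≡ k) ×
            (∀ S → IsMobileGPSet S → length S ≤ k)

record FinGraph (n : ℕ) : Set where
  field
    adj        : Fin n → Fin n → Bool
    adj-symm   : ∀ i j → adj i j ≡ adj j i
    adj-irr    : ∀ i → adj i i ≡ false
open FinGraph public

toGraph : ∀ {n} → FinGraph n → Graph
toGraph {n} T = record
  { V = Fin n ; Adj = λ i j → adj T i j ≡ true
  ; adj-sym = λ {i} {j} e → Eq.trans (adj-symm T j i) e
  ; adj-irrefl = λ {i} e → f (Eq.trans (Eq.sym (adj-irr T i)) e) }
  where
  f : false ≡ true → ⊥
  f ()

degree : ∀ {n} → FinGraph n → Fin n → ℕ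
degree {n} T i = length (filter (λ j → adj T i j Data.Bool.≟ true) (allFin n))

leaves : ∀ {n} → FinGraph n → ℕ
leaves {n} T = length (filter (λ i → degree T i ≟ 1) (allFin n))

Connected : Graph → Set
Connected G = ∀ x y → Walk G x y

HasCycle : Graph → Set
HasCycle G = Σ (V G) λ x → Σ (Walk G x x) λ p →
  3 ≤ walkLength G p × Unique (tail' (verts G p))
  where
  tail' : List (V G) → List (V G)
  tail' []       = []
  tail' (_ ∷ xs) = xs

IsTree : ∀ {n} → FinGraph n → Set
IsTree T = Connected (toGraph T) × ¬ HasCycle (toGraph T)

module Submission where

-- Distances in T □ K₂ are d(x, y) + [i ≢ j], so three vertices lie on a common geodesic
-- exactly when their projections do in T and the middle one shares its layer with an end.
--
-- If a general position set has more robots than T has leaves, its projections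
-- are distinct and one of them lies strictly between two others: otherwise every projection has
-- a leaf behind it, as seen from the other projections, and these leaves are distinct.  By the
-- median property of trees such an interior robot is alone in its layer, hence unique, and
-- after every legal move the interior robot is in the same layer as before.  So no leaf of T is
-- ever visited in that layer: a robot there would be the interior robot, but leaves never lie
-- strictly between two vertices.
--
-- Put one robot on every leaf, one of them in layer 0 and the others in layer 1.
-- The lone robot tours layer 0 along geodesics, which meet leaves only at their ends, steps up,
-- the other robots step down one at a time, and the lone robot tours layer 1.

open import Defs

open import Data.Bool using (true)
import Data.Bool.Properties as Bool
open import Data.Empty using (⊥; ⊥-elim)
open import Data.Fin using (Fin)
import Data.Fin as Fin
import Data.Fin.Properties as Fin
open import Data.Fin.Patterns using (0F; 1F)
open import Data.List using (List; []; _∷_; _++_; _∷ʳ_; length; map; filter; allFin)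
open import Data.List.Extrema.Nat using (argmax; argmax-all; f[xs]≤f[argmax])
open import Data.List.Membership.Propositional using (_∈_; _∉_; find; lose)
open import Data.List.Membership.Propositional.Properties
  using (∈-++⁻; ∈-insert; ∈-∃++; ∈-filter⁺; ∈-filter⁻; ∈-allFin; ∈-map⁺; ∈-map⁻; ∈-lookup)
open import Data.List.Properties using (length-map; map-∘; map-id; map-++; ∷ʳ-++)
open import Data.List.Relation.Unary.All using ([]; _∷_)
import Data.List.Relation.Unary.All as All
open import Data.List.Relation.Unary.All.Properties using (¬Any⇒All¬; all-filter)
open import Data.List.Relation.Unary.AllPairs using ([]; _∷_)
open import Data.List.Relation.Unary.Any using (Any; here; there)
import Data.List.Relation.Unary.Any as Any
open import Data.List.Relation.Unary.Unique.Propositional using (Unique)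
open import Data.List.Relation.Unary.Unique.Propositional.Properties
  using (Unique[x∷xs]⇒x∉xs; ++⁺; filter⁺; allFin⁺; map⁻)
open import Data.Nat using (ℕ; zero; suc; _+_; _≤_; _<_; z≤n; s≤s)
import Data.Nat as ℕ
open import Data.Nat.Induction using (<-wellFounded)
open import Data.Nat.Properties
open import Algebra.Properties.CommutativeSemigroup +-commutativeSemigroup using (interchange)
open import Data.Product using (Σ; ∃; ∃₂; _×_; _,_; proj₁; proj₂)
open import Data.Product.Properties using (≡-dec)
open import Data.Sum using (_⊎_; inj₁; inj₂)
open import Function using (_∘_; case_of_)
open import Induction.WellFounded using (Acc; acc)
open import Relation.Binary.Construct.Closure.ReflexiveTransitive using (Star; ε; _◅_; _◅◅_)
open import Relation.Binary.Definitions using (tri<; tri≈; tri>; DecidableEquality)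
open import Relation.Binary.PropositionalEquality
  using (_≡_; _≢_; refl; sym; trans; cong; cong₂; subst; subst₂; module ≡-Reasoning)
open import Relation.Nullary using (¬_; Dec; yes; no)
open import Relation.Nullary.Decidable using (_×-dec_; ¬?; decidable-stable)
import Relation.Nullary.Decidable as Dec
open import Relation.Unary using (Decidable)

module _ {A : Set} where

  ∈-insert⁻ : ∀ xs {ys : List A} {u w} → w ∈ xs ++ u ∷ ys → w ≢ u → w ∈ xs ++ ys
  ∈-insert⁻ []       (here w≡u)  w≢u = ⊥-elim (w≢u w≡u)
  ∈-insert⁻ []       (there w∈)  _   = w∈
  ∈-insert⁻ (x ∷ xs) (here w≡x)  _   = here w≡x
  ∈-insert⁻ (x ∷ xs) (there w∈)  w≢u = there (∈-insert⁻ xs w∈ w≢u)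

  ∈-insert⁺ : ∀ xs {ys : List A} {u w} → w ∈ xs ++ ys → w ∈ xs ++ u ∷ ys
  ∈-insert⁺ []       w∈         = there w∈
  ∈-insert⁺ (x ∷ xs) (here w≡x) = here w≡x
  ∈-insert⁺ (x ∷ xs) (there w∈) = there (∈-insert⁺ xs w∈)

  length-insert : ∀ xs {ys : List A} {u} → length (xs ++ u ∷ ys) ≡ suc (length (xs ++ ys))
  length-insert []       = refl
  length-insert (x ∷ xs) = cong suc (length-insert xs)

  ∉⇒Unique-∷ : ∀ {x : A} {xs} → x ∉ xs → Unique xs → Unique (x ∷ xs)
  ∉⇒Unique-∷ x∉xs !xs = ¬Any⇒All¬ _ x∉xs ∷ !xs

  map-insert : ∀ {B : Set} (f : A → B) xs {ys : List A} {u v} → f u ≡ f v →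
               map f (xs ++ u ∷ ys) ≡ map f (xs ++ v ∷ ys)
  map-insert f [] {ys} fu≡fv = cong (_∷ map f ys) fu≡fv
  map-insert f (x ∷ xs) fu≡fv = cong (f x ∷_) (map-insert f xs fu≡fv)

  Unique-insert⁻ : ∀ xs {ys : List A} {u} → Unique (xs ++ u ∷ ys) → u ∉ xs ++ ys × Unique (xs ++ ys)
  Unique-insert⁻ []       !u∷ys@(_ ∷ !ys) = Unique[x∷xs]⇒x∉xs !u∷ys , !ys
  Unique-insert⁻ (x ∷ xs) {ys} {u} !x∷rest@(_ ∷ !rest) with Unique-insert⁻ xs !rest
  ... | u∉ , !xs++ys = u∉x∷ , ∉⇒Unique-∷ (x∉rest ∘ ∈-insert⁺ xs) !xs++ys
    where
    x∉rest = Unique[x∷xs]⇒x∉xs !x∷rest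
    u∉x∷ : u ∉ x ∷ xs ++ ys
    u∉x∷ (here refl) = x∉rest (∈-insert xs)
    u∉x∷ (there u∈)  = u∉ u∈

Unique-∷ʳ : {A : Set} {xs : List A} {y : A} → Unique xs → y ∉ xs → Unique (xs ++ y ∷ [])
Unique-∷ʳ !xs y∉xs = ++⁺ !xs ([] ∷ []) λ where (y∈xs , here refl) → y∉xs y∈xs

module _ {A B : Set} (f : A → B) where

  Unique-map⁻-injective : ∀ {xs x y} → Unique (map f xs) → x ∈ xs → y ∈ xs → f x ≡ f y → x ≡ y
  Unique-map⁻-injective _ (here refl) (here refl) _ = refl
  Unique-map⁻-injective {_ ∷ xs} !fxs@(_ ∷ _) (here refl) (there y∈) fx≡fy =
    ⊥-elim (Unique[x∷xs]⇒x∉xs !fxs (subst (_∈ map f xs) (sym fx≡fy) (∈-map⁺ f y∈)))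
  Unique-map⁻-injective {_ ∷ xs} !fxs@(_ ∷ _) (there x∈) (here refl) fx≡fy =
    ⊥-elim (Unique[x∷xs]⇒x∉xs !fxs (subst (_∈ map f xs) fx≡fy (∈-map⁺ f x∈)))
  Unique-map⁻-injective (_ ∷ !fxs) (there x∈) (there y∈) fx≡fy = Unique-map⁻-injective !fxs x∈ y∈ fx≡fy

  Unique-map⁺-injective : ∀ {xs} → (∀ {x y} → x ∈ xs → y ∈ xs → f x ≡ f y → x ≡ y) → Unique xs → Unique (map f xs)
  Unique-map⁺-injective {[]}     _   _ = []
  Unique-map⁺-injective {x ∷ xs} inj !x∷xs@(_ ∷ !xs) =
    ∉⇒Unique-∷ fx∉ (Unique-map⁺-injective (λ x∈ y∈ → inj (there x∈) (there y∈)) !xs)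
    where
    fx∉ : f x ∉ map f xs
    fx∉ fx∈ with y , y∈ , fx≡fy ← ∈-map⁻ f fx∈ =
      Unique[x∷xs]⇒x∉xs !x∷xs (subst (_∈ xs) (sym (inj (here refl) (there y∈) fx≡fy)) y∈)

module _ {A : Set} (_≟_ : DecidableEquality A) where

  avoid-one : ∀ {xs : List A} → Unique xs → 2 ≤ length xs → ∀ b → ∃ λ c → c ∈ xs × c ≢ b
  avoid-one {_ ∷ []} _ (s≤s ()) _
  avoid-one {x ∷ y ∷ _} ((x≢y ∷ _) ∷ _) _ b with x ≟ b
  ... | yes refl = y , there (here refl) , x≢y ∘ sym
  ... | no x≢b   = x , here refl , x≢b

  avoid-two : ∀ {xs : List A} → Unique xs → 3 ≤ length xs → ∀ a b → ∃ λ c → c ∈ xs × c ≢ a × c ≢ b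
  avoid-two {x ∷ xs} !x∷xs@(_ ∷ !xs) (s≤s 2≤) a b with x ≟ a | x ≟ b
  ... | no x≢a | no x≢b = x , here refl , x≢a , x≢b
  ... | yes refl | _ with c , c∈ , c≢b ← avoid-one !xs 2≤ b =
    c , there c∈ , (λ where refl → Unique[x∷xs]⇒x∉xs !x∷xs c∈) , c≢b
  avoid-two {x ∷ xs} !x∷xs@(_ ∷ !xs) (s≤s 2≤) a b | no _ | yes refl with c , c∈ , c≢a ← avoid-one !xs 2≤ a =
    c , there c∈ , c≢a , (λ where refl → Unique[x∷xs]⇒x∉xs !x∷xs c∈)

length-≤-by-injection : {A B : Set} {xs : List A} {ys : List B} → Unique xs →
  (f : ∀ {x} → x ∈ xs → B) → (∀ {x} (x∈ : x ∈ xs) → f x∈ ∈ ys) →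
  (∀ {x y} (x∈ : x ∈ xs) (y∈ : y ∈ xs) → f x∈ ≡ f y∈ → x ≡ y) →
  length xs ≤ length ys
length-≤-by-injection {xs = []}     _ _ _ _ = z≤n
length-≤-by-injection {xs = x ∷ xs} !x∷xs@(_ ∷ !xs) f f∈ f-inj
  with as , bs , refl ← ∈-∃++ (f∈ (here refl)) =
  subst (suc (length xs) ≤_) (sym (length-insert as))
    (s≤s (length-≤-by-injection !xs (f ∘ there) f∈′ λ x∈ y∈ → f-inj (there x∈) (there y∈)))
  where
  f∈′ : ∀ {y} (y∈ : y ∈ xs) → f (there y∈) ∈ as ++ bs
  f∈′ y∈ = ∈-insert⁻ as (f∈ (there y∈)) λ fy≡fx →
    Unique[x∷xs]⇒x∉xs !x∷xs (subst (_∈ xs) (f-inj (there y∈) (here refl) fy≡fx) y∈)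

least : {P : ℕ → Set} → Decidable P → ∀ {n} → P n → ∃ λ m → P m × (∀ {k} → P k → m ≤ k)
least {P} P? {n} Pn = search n Pn (<-wellFounded n)
  where
  search : ∀ n → P n → Acc _<_ n → ∃ λ m → P m × (∀ {k} → P k → m ≤ k)
  search n Pn (acc below) with anyUpTo? P? n
  ... | yes (k , k<n , Pk) = search k Pk (below k<n)
  ... | no ¬smaller        = n , Pn , λ {k} Pk → ≮⇒≥ (λ k<n → ¬smaller (k , k<n , Pk))

+-squeeze : ∀ {a b c d} → a ≤ c → b ≤ d → c + d ≤ a + b → c ≡ a × d ≡ b
+-squeeze {a} {b} {c} {d} a≤c b≤d c+d≤a+b =
  ≤-antisym (+-cancelʳ-≤ b c a (≤-trans (+-monoʳ-≤ c b≤d) c+d≤a+b)) a≤c ,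
  ≤-antisym (+-cancelˡ-≤ a d b (≤-trans (+-monoˡ-≤ d a≤c) c+d≤a+b)) b≤d

module WalkProperties (G : Graph) where

  private
    ∣_∣ : ∀ {x y} → Walk G x y → ℕ
    ∣_∣ = walkLength G

  _++ᵂ_ : ∀ {x y z} → Walk G x y → Walk G y z → Walk G x z
  [ _ ]        ++ᵂ q = q
  (x ∷⟨ e ⟩ p) ++ᵂ q = x ∷⟨ e ⟩ (p ++ᵂ q)

  length-++ᵂ : ∀ {x y z} (p : Walk G x y) (q : Walk G y z) → ∣ p ++ᵂ q ∣ ≡ ∣ p ∣ + ∣ q ∣
  length-++ᵂ [ _ ]        q = refl
  length-++ᵂ (x ∷⟨ e ⟩ p) q = cong suc (length-++ᵂ p q)

  source∈verts : ∀ {x y} (p : Walk G x y) → x ∈ verts G p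
  source∈verts [ _ ]         = here refl
  source∈verts (_ ∷⟨ _ ⟩ _) = here refl

  target∈verts : ∀ {x y} (p : Walk G x y) → y ∈ verts G p
  target∈verts [ _ ]        = here refl
  target∈verts (_ ∷⟨ _ ⟩ p) = there (target∈verts p)

  ∈-++ᵂ⁺ˡ : ∀ {x y z w} (p : Walk G x y) (q : Walk G y z) → w ∈ verts G p → w ∈ verts G (p ++ᵂ q)
  ∈-++ᵂ⁺ˡ [ _ ]        q (here refl) = source∈verts q
  ∈-++ᵂ⁺ˡ (_ ∷⟨ _ ⟩ p) q (here refl) = here refl
  ∈-++ᵂ⁺ˡ (_ ∷⟨ _ ⟩ p) q (there w∈)  = there (∈-++ᵂ⁺ˡ p q w∈)

  ∈-++ᵂ⁺ʳ : ∀ {x y z w} (p : Walk G x y) (q : Walk G y z) → w ∈ verts G q → w ∈ verts G (p ++ᵂ q)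
  ∈-++ᵂ⁺ʳ [ _ ]        q w∈ = w∈
  ∈-++ᵂ⁺ʳ (_ ∷⟨ _ ⟩ p) q w∈ = there (∈-++ᵂ⁺ʳ p q w∈)

  ≢⇒0<length : ∀ {x y} → x ≢ y → (p : Walk G x y) → 0 < ∣ p ∣
  ≢⇒0<length x≢x [ _ ]        = ⊥-elim (x≢x refl)
  ≢⇒0<length _   (_ ∷⟨ _ ⟩ _) = s≤s z≤n

  ∈-++ᵂ⁻ : ∀ {x y z w} (p : Walk G x y) (q : Walk G y z) → w ∈ verts G (p ++ᵂ q) → w ∈ verts G p ⊎ w ∈ verts G q
  ∈-++ᵂ⁻ [ _ ]        q w∈         = inj₂ w∈
  ∈-++ᵂ⁻ (_ ∷⟨ _ ⟩ p) q (here refl) = inj₁ (here refl)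
  ∈-++ᵂ⁻ (_ ∷⟨ _ ⟩ p) q (there w∈) with ∈-++ᵂ⁻ p q w∈
  ... | inj₁ w∈p = inj₁ (there w∈p)
  ... | inj₂ w∈q = inj₂ w∈q

  _∷ʳ⟨_⟩ : ∀ {x y z} → Walk G x y → Adj G y z → Walk G x z
  [ y ]         ∷ʳ⟨ e ⟩ = y ∷⟨ e ⟩ [ _ ]
  (x ∷⟨ e₁ ⟩ p) ∷ʳ⟨ e ⟩ = x ∷⟨ e₁ ⟩ (p ∷ʳ⟨ e ⟩)

  length-∷ʳ : ∀ {x y z} (p : Walk G x y) (e : Adj G y z) → ∣ p ∷ʳ⟨ e ⟩ ∣ ≡ suc ∣ p ∣
  length-∷ʳ [ y ]        e = refl
  length-∷ʳ (x ∷⟨ _ ⟩ p) e = cong suc (length-∷ʳ p e)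

  verts-∷ʳ : ∀ {x y z} (p : Walk G x y) (e : Adj G y z) → verts G (p ∷ʳ⟨ e ⟩) ≡ verts G p ++ z ∷ []
  verts-∷ʳ [ y ]        e = refl
  verts-∷ʳ (x ∷⟨ _ ⟩ p) e = cong (x ∷_) (verts-∷ʳ p e)

  reverse : ∀ {x y} → Walk G x y → Walk G y x
  reverse [ x ]        = [ x ]
  reverse (x ∷⟨ e ⟩ p) = reverse p ∷ʳ⟨ adj-sym G e ⟩

  length-reverse : ∀ {x y} (p : Walk G x y) → ∣ reverse p ∣ ≡ ∣ p ∣
  length-reverse [ x ]        = refl
  length-reverse (x ∷⟨ e ⟩ p) = trans (length-∷ʳ (reverse p) (adj-sym G e)) (cong suc (length-reverse p))

  record SplitAt {x y} (p : Walk G x y) (z : V G) : Set where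
    field
      prefix      : Walk G x z
      suffix      : Walk G z y
      length-sum  : ∣ prefix ∣ + ∣ suffix ∣ ≡ ∣ p ∣
      verts-cover : ∀ {w} → w ∈ verts G p → w ∈ verts G prefix ⊎ w ∈ verts G suffix

  splitAt : ∀ {x y z} (p : Walk G x y) → z ∈ verts G p → SplitAt p z
  splitAt [ x ] (here refl) = record
    { prefix = [ x ] ; suffix = [ x ] ; length-sum = refl ; verts-cover = inj₁ }
  splitAt (x ∷⟨ e ⟩ p) (here refl) = record
    { prefix = [ x ] ; suffix = x ∷⟨ e ⟩ p ; length-sum = refl ; verts-cover = inj₂ }
  splitAt (x ∷⟨ e ⟩ p) (there z∈) = record
    { prefix = x ∷⟨ e ⟩ prefix ; suffix = suffix ; length-sum = cong suc length-sum ; verts-cover = cover }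
    where
    open SplitAt (splitAt p z∈)
    cover : ∀ {w} → w ∈ x ∷ verts G p → w ∈ x ∷ verts G prefix ⊎ w ∈ verts G suffix
    cover (here w≡x) = inj₁ (here w≡x)
    cover (there w∈) with verts-cover w∈
    ... | inj₁ w∈pre = inj₁ (there w∈pre)
    ... | inj₂ w∈suf = inj₂ w∈suf

module Geodesics (G : Graph) (D : V G → V G → ℕ)
  (D≤length : ∀ {x y} (p : Walk G x y) → D x y ≤ walkLength G p)
  (geodesic : ∀ x y → Σ (Walk G x y) λ p → walkLength G p ≡ D x y) where

  open WalkProperties G

  IsGeodesic : ∀ {x y} → Walk G x y → Set
  IsGeodesic {x} {y} p = walkLength G p ≡ D x y

  D-refl : ∀ x → D x x ≡ 0
  D-refl x = n≤0⇒n≡0 (D≤length [ x ])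

  D≡0⇒≡ : ∀ {x y} → D x y ≡ 0 → x ≡ y
  D≡0⇒≡ {x} {y} Dxy≡0 with geodesic x y
  ... | [ _ ] , _ = refl
  ... | (_ ∷⟨ _ ⟩ _) , p-geo with () ← trans p-geo Dxy≡0

  D-sym : ∀ x y → D x y ≡ D y x
  D-sym x y = ≤-antisym (≤-reverse x y) (≤-reverse y x)
    where
    ≤-reverse : ∀ x y → D x y ≤ D y x
    ≤-reverse x y with p , p-geo ← geodesic y x =
      subst (D x y ≤_) (trans (length-reverse p) p-geo) (D≤length (reverse p))

  D-triangle : ∀ x y z → D x z ≤ D x y + D y z
  D-triangle x y z with p , p-geo ← geodesic x y | q , q-geo ← geodesic y z =
    subst (D x z ≤_) (trans (length-++ᵂ p q) (cong₂ _+_ p-geo q-geo)) (D≤length (p ++ᵂ q))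

  Between : V G → V G → V G → Set
  Between x y z = D x y + D y z ≡ D x z

  Between-sym : ∀ {x y z} → Between x y z → Between z y x
  Between-sym {x} {y} {z} xyz = begin
    D z y + D y x ≡⟨ cong₂ _+_ (D-sym z y) (D-sym y x) ⟩
    D y z + D x y ≡⟨ +-comm (D y z) (D x y) ⟩
    D x y + D y z ≡⟨ xyz ⟩
    D x z         ≡⟨ D-sym x z ⟩
    D z x         ∎
    where open ≡-Reasoning

  Between-endˡ : ∀ x y → Between x x y
  Between-endˡ x y = cong (_+ D x y) (D-refl x)

  Between-endʳ : ∀ x y → Between x y y
  Between-endʳ x y = trans (cong (D x y +_) (D-refl y)) (+-identityʳ (D x y))

  Between-antisym : ∀ {x y z} → Between x y z → Between y x z → x ≡ y
  Between-antisym {x} {y} {z} xyz yxz = D≡0⇒≡ (m+n≡0⇒m≡0 (D x y) (+-cancelʳ-≡ (D x z) (D x y + D x y) 0 (begin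
    D x y + D x y + D x z   ≡⟨ +-assoc (D x y) (D x y) (D x z) ⟩
    D x y + (D x y + D x z) ≡⟨ cong (λ d → D x y + (d + D x z)) (D-sym x y) ⟩
    D x y + (D y x + D x z) ≡⟨ cong (D x y +_) yxz ⟩
    D x y + D y z           ≡⟨ xyz ⟩
    D x z                   ∎)))
    where open ≡-Reasoning

  Between-chain : ∀ {x u v w} → Between x u v → Between x v w → Between u v w
  Between-chain {x} {u} {v} {w} xuv xvw = ≤-antisym (+-cancelˡ-≤ (D x u) _ _ uvw≤uw) (D-triangle u v w)
    where
    open ≤-Reasoning
    uvw≤uw : D x u + (D u v + D v w) ≤ D x u + D u w
    uvw≤uw = begin
      D x u + (D u v + D v w) ≡⟨ sym (+-assoc (D x u) (D u v) (D v w)) ⟩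
      D x u + D u v + D v w   ≡⟨ cong (_+ D v w) xuv ⟩
      D x v + D v w           ≡⟨ xvw ⟩
      D x w                   ≤⟨ D-triangle x u w ⟩
      D x u + D u w           ∎

  split-geodesic : ∀ {x y z} {p : Walk G x y} → IsGeodesic p → (s : SplitAt p z) →
                   IsGeodesic (SplitAt.prefix s) × IsGeodesic (SplitAt.suffix s)
  split-geodesic {x} {y} {z} {p} p-geo s =
    +-squeeze (D≤length prefix) (D≤length suffix) (begin
      walkLength G prefix + walkLength G suffix ≡⟨ length-sum ⟩
      walkLength G p                            ≡⟨ p-geo ⟩
      D x y                                     ≤⟨ D-triangle x z y ⟩
      D x z + D z y                             ∎)
    where
    open SplitAt s
    open ≤-Reasoning

  ∈-geodesic⇒Between : ∀ {x y z} {p : Walk G x y} → IsGeodesic p → z ∈ verts G p → Between x z y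
  ∈-geodesic⇒Between {p = p} p-geo z∈ =
    trans (sym (cong₂ _+_ prefix-geo suffix-geo)) (trans length-sum p-geo)
    where
    s = splitAt p z∈
    open SplitAt s
    prefix-geo = proj₁ (split-geodesic p-geo s)
    suffix-geo = proj₂ (split-geodesic p-geo s)

  geodesic-ordered : ∀ {x y u v} {p : Walk G x y} → IsGeodesic p → u ∈ verts G p → v ∈ verts G p →
                     Between x u v ⊎ Between x v u
  geodesic-ordered {p = p} p-geo u∈ v∈
    with split-geodesic p-geo (splitAt p v∈) | SplitAt.verts-cover (splitAt p v∈) u∈
  ... | prefix-geo , _ | inj₁ u∈prefix = inj₁ (∈-geodesic⇒Between prefix-geo u∈prefix)
  ... | _ , suffix-geo | inj₂ u∈suffix = inj₂ (Between-sym (Between-chain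
          (Between-sym (∈-geodesic⇒Between suffix-geo u∈suffix))
          (Between-sym (∈-geodesic⇒Between p-geo v∈))))

  three-on-geodesic : ∀ {x y u v w} {p : Walk G x y} → IsGeodesic p →
                      u ∈ verts G p → v ∈ verts G p → w ∈ verts G p →
                      Between u v w ⊎ Between v u w ⊎ Between u w v
  three-on-geodesic p-geo u∈ v∈ w∈ with geodesic-ordered p-geo u∈ v∈ | geodesic-ordered p-geo v∈ w∈
  ... | inj₁ uv | inj₁ vw = inj₁ (Between-chain uv vw)
  ... | inj₂ vu | inj₂ wv = inj₁ (Between-sym (Between-chain wv vu))
  ... | inj₁ uv | inj₂ wv with geodesic-ordered p-geo u∈ w∈
  ...   | inj₁ uw = inj₂ (inj₂ (Between-chain uw wv))
  ...   | inj₂ wu = inj₂ (inj₁ (Between-sym (Between-chain wu uv)))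
  three-on-geodesic p-geo u∈ v∈ w∈ | inj₂ vu | inj₁ vw with geodesic-ordered p-geo u∈ w∈
  ...   | inj₁ uw = inj₂ (inj₁ (Between-chain vu uw))
  ...   | inj₂ wu = inj₂ (inj₂ (Between-sym (Between-chain vw wu)))

  shortest⇒geodesic : ∀ {x y} (p : Walk G x y) → IsShortest G p → IsGeodesic p
  shortest⇒geodesic {x} {y} p p-short with q , q-geo ← geodesic x y =
    ≤-antisym (subst (walkLength G p ≤_) q-geo (p-short q)) (D≤length p)

  Between⇒OnCommonGeodesic : ∀ {a b c} → Between a b c → OnCommonGeodesic G a b c
  Between⇒OnCommonGeodesic {a} {b} {c} abc
    with p , p-geo ← geodesic a b | q , q-geo ← geodesic b c =
    a , c , p ++ᵂ q , shortest ,
    source∈verts (p ++ᵂ q) , ∈-++ᵂ⁺ˡ p q (target∈verts p) , ∈-++ᵂ⁺ʳ p q (target∈verts q)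
    where
    shortest : IsShortest G (p ++ᵂ q)
    shortest r = subst (_≤ walkLength G r)
      (sym (trans (length-++ᵂ p q) (trans (cong₂ _+_ p-geo q-geo) abc))) (D≤length r)

  NoneBetween : List (V G) → Set
  NoneBetween C = ∀ {a b c} → a ∈ C → b ∈ C → c ∈ C → a ≢ b → b ≢ c → a ≢ c → ¬ Between a b c

  IsGPSet⇒NoneBetween : ∀ {C} → IsGPSet G C → NoneBetween C
  IsGPSet⇒NoneBetween (_ , gp) a∈ b∈ c∈ a≢b b≢c a≢c abc =
    gp _ _ _ a∈ b∈ c∈ a≢b b≢c a≢c (Between⇒OnCommonGeodesic abc)

  NoneBetween⇒IsGPSet : ∀ {C} → Unique C → NoneBetween C → IsGPSet G C
  NoneBetween⇒IsGPSet !C none = !C , λ where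
    a b c a∈ b∈ c∈ a≢b b≢c a≢c (_ , _ , p , p-short , a∈p , b∈p , c∈p) →
      case three-on-geodesic (shortest⇒geodesic p p-short) a∈p b∈p c∈p of λ where
        (inj₁ abc)        → none a∈ b∈ c∈ a≢b b≢c a≢c abc
        (inj₂ (inj₁ bac)) → none b∈ a∈ c∈ (a≢b ∘ sym) a≢c b≢c bac
        (inj₂ (inj₂ acb)) → none a∈ c∈ b∈ a≢c (b≢c ∘ sym) a≢b acb

module Distance {n} (T : FinGraph n) (conn : Connected (toGraph T)) where

  TG : Graph
  TG = toGraph T

  open WalkProperties TG

  _~_ : Fin n → Fin n → Set
  _~_ = Adj TG

  ~-irrefl : ∀ {x y} → x ~ y → x ≢ y
  ~-irrefl x~y refl = adj-irrefl TG x~y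

  WalkOfLength : ℕ → Fin n → Fin n → Set
  WalkOfLength k x y = Σ (Walk TG x y) λ p → walkLength TG p ≡ k

  walkOfLength? : ∀ k x y → Dec (WalkOfLength k x y)
  walkOfLength? zero x y with x Fin.≟ y
  ... | yes refl = yes ([ x ] , refl)
  ... | no x≢y   = no λ where
    ([ _ ] , _)          → x≢y refl
    ((_ ∷⟨ _ ⟩ _) , ())
  walkOfLength? (suc k) x y with Fin.any? (λ z → (adj T x z Bool.≟ true) ×-dec walkOfLength? k z y)
  ... | yes (z , x~z , p , p-len) = yes ((x ∷⟨ x~z ⟩ p) , cong suc p-len)
  ... | no ∄z = no λ where
    ([ _ ] , ())
    ((_ ∷⟨ x~z ⟩ p) , p-len) → ∄z (_ , x~z , p , suc-injective p-len)

  opaque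
    shortest-length : ∀ x y → ∃ λ m → WalkOfLength m x y × (∀ {k} → WalkOfLength k x y → m ≤ k)
    shortest-length x y = least (λ k → walkOfLength? k x y) (conn x y , refl)

  dist : Fin n → Fin n → ℕ
  dist x y = proj₁ (shortest-length x y)

  dist≤length : ∀ {x y} (p : Walk TG x y) → dist x y ≤ walkLength TG p
  dist≤length {x} {y} p = proj₂ (proj₂ (shortest-length x y)) (p , refl)

  dist-geodesic : ∀ x y → WalkOfLength (dist x y) x y
  dist-geodesic x y = proj₁ (proj₂ (shortest-length x y))

  open Geodesics TG dist dist≤length dist-geodesic public

  ~⇒dist≡1 : ∀ {x y} → x ~ y → dist x y ≡ 1
  ~⇒dist≡1 {x} {y} x~y with dist x y in eq | dist≤length (x ∷⟨ x~y ⟩ [ y ])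
  ... | zero        | _         = ⊥-elim (~-irrefl x~y (D≡0⇒≡ eq))
  ... | suc zero    | _         = refl
  ... | suc (suc _) | s≤s ()

  dist-step : ∀ {x v y} → v ~ y → dist x y ≤ suc (dist x v)
  dist-step {x} {v} {y} v~y = begin
    dist x y            ≤⟨ D-triangle x v y ⟩
    dist x v + dist v y ≡⟨ cong (dist x v +_) (~⇒dist≡1 v~y) ⟩
    dist x v + 1        ≡⟨ +-comm (dist x v) 1 ⟩
    suc (dist x v)      ∎
    where open ≤-Reasoning

  dist-stepˡ : ∀ {x x′ y} → x ~ x′ → dist x y ≤ suc (dist x′ y)
  dist-stepˡ {x} {x′} {y} x~x′ =
    subst₂ _≤_ (D-sym y x) (cong suc (D-sym y x′)) (dist-step (adj-sym TG x~x′))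

  Parent : Fin n → Fin n → Fin n → Set
  Parent x v p = v ~ p × suc (dist x p) ≡ dist x v

  parent : ∀ {x v} → x ≢ v → ∃ (Parent x v)
  parent {x} {v} x≢v with dist-geodesic v x
  ... | [ _ ] , _ = ⊥-elim (x≢v refl)
  ... | (_∷⟨_⟩_ _ {p} v~p q) , q-geo = p , v~p , ≤-antisym (begin
      suc (dist x p)          ≡⟨ cong suc (D-sym x p) ⟩
      suc (dist p x)          ≤⟨ s≤s (dist≤length q) ⟩
      suc (walkLength TG q)   ≡⟨ q-geo ⟩
      dist v x                ≡⟨ D-sym v x ⟩
      dist x v                ∎) (dist-step (adj-sym TG v~p))
    where open ≤-Reasoning

  shared-parent⇒¬Between : ∀ {a b v q} → Parent a v q → Parent b v q → ¬ Between a v b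
  shared-parent⇒¬Between {a} {b} {v} {q} (_ , a-via-q) (_ , b-via-q) avb = <⇒≱ (begin-strict
    dist a q + dist q b             <⟨ +-mono-< (n<1+n (dist a q)) (n<1+n (dist q b)) ⟩
    suc (dist a q) + suc (dist q b) ≡⟨ cong₂ _+_ a-via-q (trans (cong suc (D-sym q b)) (trans b-via-q (D-sym b v))) ⟩
    dist a v + dist v b             ≡⟨ avb ⟩
    dist a b                        ∎) (D-triangle a q b)
    where open ≤-Reasoning

  IsLeaf : Fin n → Set
  IsLeaf v = Σ (Fin n) λ q → v ~ q × (∀ {y} → v ~ y → y ≡ q)

  leaf-not-between : ∀ {l a b} → IsLeaf l → a ≢ l → b ≢ l → ¬ Between a l b
  leaf-not-between (q , _ , unique) a≢l b≢l
    with pa , a-parent ← parent a≢l | pb , b-parent ← parent b≢l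
    with refl ← unique (proj₁ a-parent) | refl ← unique (proj₁ b-parent) =
    shared-parent⇒¬Between a-parent b-parent

  neighbours : Fin n → List (Fin n)
  neighbours v = filter (λ w → adj T v w Bool.≟ true) (allFin n)

  ∈-neighbours⁺ : ∀ {v w} → v ~ w → w ∈ neighbours v
  ∈-neighbours⁺ v~w = ∈-filter⁺ (λ w → adj T _ w Bool.≟ true) (∈-allFin _) v~w

  ∈-neighbours⁻ : ∀ {v w} → w ∈ neighbours v → v ~ w
  ∈-neighbours⁻ w∈ = proj₂ (∈-filter⁻ (λ w → adj T _ w Bool.≟ true) {xs = allFin n} w∈)

  degree≡1⇒IsLeaf : ∀ {v} → degree T v ≡ 1 → IsLeaf v
  degree≡1⇒IsLeaf {v} deg with neighbours v in eq | deg
  ... | q ∷ [] | _ = q , ∈-neighbours⁻ (subst (q ∈_) (sym eq) (here refl)) , unique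
    where
    unique : ∀ {y} → v ~ y → y ≡ q
    unique v~y with here y≡q ← subst (_ ∈_) eq (∈-neighbours⁺ v~y) = y≡q

  IsLeaf⇒degree≡1 : ∀ {v} → IsLeaf v → degree T v ≡ 1
  IsLeaf⇒degree≡1 {v} (q , v~q , unique) = singleton (neighbours v)
    (filter⁺ (λ w → adj T v w Bool.≟ true) (allFin⁺ n)) (∈-neighbours⁺ v~q) (unique ∘ ∈-neighbours⁻)
    where
    singleton : ∀ xs → Unique xs → q ∈ xs → (∀ {y} → y ∈ xs → y ≡ q) → length xs ≡ 1
    singleton (_ ∷ [])     _   _ _     = refl
    singleton (x ∷ y ∷ xs) !xs _ all-q = ⊥-elim (Unique[x∷xs]⇒x∉xs !xs
      (here (trans (all-q (here refl)) (sym (all-q (there (here refl)))))))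

  leafList : List (Fin n)
  leafList = filter (λ v → degree T v ℕ.≟ 1) (allFin n)

  Unique-leafList : Unique leafList
  Unique-leafList = filter⁺ (λ v → degree T v ℕ.≟ 1) (allFin⁺ n)

  IsLeaf⇒∈leafList : ∀ {v} → IsLeaf v → v ∈ leafList
  IsLeaf⇒∈leafList v-leaf = ∈-filter⁺ (λ v → degree T v ℕ.≟ 1) (∈-allFin _) (IsLeaf⇒degree≡1 v-leaf)

  ∈leafList⇒IsLeaf : ∀ {v} → v ∈ leafList → IsLeaf v
  ∈leafList⇒IsLeaf v∈ = degree≡1⇒IsLeaf (proj₂ (∈-filter⁻ (λ v → degree T v ℕ.≟ 1) {xs = allFin n} v∈))

module Tree {n} (T : FinGraph n) (conn : Connected (toGraph T)) (acyc : ¬ HasCycle (toGraph T)) where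

  open Distance T conn public
  open WalkProperties TG

  private
    ∉-above : ∀ {k x w} {zs : List (Fin n)} → (∀ {z} → z ∈ zs → suc k ≤ dist x z) → dist x w ≡ k → w ∉ zs
    ∉-above above w-level w∈ = 1+n≰n (subst (_ ≤_) w-level (above w∈))

    source≢ : ∀ {x w k} → dist x w ≡ suc k → x ≢ w
    source≢ {x} w-level refl with () ← trans (sym (D-refl x)) w-level

  -- Replacing both ends by their parents towards x either closes the path into a cycle
  -- (equal parents) or yields such a path one level lower.
  no-level-path : ∀ k x {a b} (c : Walk TG a b) → a ≢ b → dist x a ≡ k → dist x b ≡ k →
                  Unique (verts TG c) → (∀ {z} → z ∈ verts TG c → k ≤ dist x z) → ⊥
  no-level-path zero x c a≢b a-level b-level _ _ =
    a≢b (trans (sym (D≡0⇒≡ a-level)) (D≡0⇒≡ b-level))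
  no-level-path (suc k) x {a} {b} c a≢b a-level b-level !c above
    with a₁ , a~a₁ , a₁-a ← parent (source≢ a-level) | b₁ , b~b₁ , b₁-b ← parent (source≢ b-level)
    with a₁-level ← suc-injective (trans a₁-a a-level) | b₁-level ← suc-injective (trans b₁-b b-level)
    with a₁ Fin.≟ b₁
  ... | yes refl = acyc (a₁ , a₁ ∷⟨ adj-sym TG a~a₁ ⟩ c′ , long , !c′)
    where
    c′ = c ∷ʳ⟨ b~b₁ ⟩
    !c′ : Unique (verts TG c′)
    !c′ = subst Unique (sym (verts-∷ʳ c b~b₁)) (Unique-∷ʳ !c (∉-above above b₁-level))
    long : 3 ≤ suc (walkLength TG c′)
    long = s≤s (subst (2 ≤_) (sym (length-∷ʳ c b~b₁)) (s≤s (≢⇒0<length a≢b c)))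
  ... | no a₁≢b₁ = no-level-path k x (a₁ ∷⟨ adj-sym TG a~a₁ ⟩ c′) a₁≢b₁ a₁-level b₁-level
                     (∉⇒Unique-∷ a₁∉c′ !c′) above′
    where
    c′ = c ∷ʳ⟨ b~b₁ ⟩
    !c′ : Unique (verts TG c′)
    !c′ = subst Unique (sym (verts-∷ʳ c b~b₁)) (Unique-∷ʳ !c (∉-above above b₁-level))
    a₁∉c′ : a₁ ∉ verts TG c′
    a₁∉c′ a₁∈ with ∈-++⁻ (verts TG c) (subst (a₁ ∈_) (verts-∷ʳ c b~b₁) a₁∈)
    ... | inj₁ a₁∈c         = ∉-above above a₁-level a₁∈c
    ... | inj₂ (here a₁≡b₁) = a₁≢b₁ a₁≡b₁
    above′ : ∀ {z} → z ∈ verts TG (a₁ ∷⟨ adj-sym TG a~a₁ ⟩ c′) → k ≤ dist x z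
    above′ (here refl) = ≤-reflexive (sym a₁-level)
    above′ (there z∈) with ∈-++⁻ (verts TG c) (subst (_ ∈_) (verts-∷ʳ c b~b₁) z∈)
    ... | inj₁ z∈c          = ≤-trans (n≤1+n k) (above z∈c)
    ... | inj₂ (here refl)  = ≤-reflexive (sym b₁-level)

  ~⇒dist≢ : ∀ {x v y} → v ~ y → dist x y ≢ dist x v
  ~⇒dist≢ {x} {v} {y} v~y level = no-level-path (dist x v) x (v ∷⟨ v~y ⟩ [ y ]) (~-irrefl v~y) refl level
    (∉⇒Unique-∷ (λ where (here v≡y) → ~-irrefl v~y v≡y) ([] ∷ []))
    λ where
      (here refl)         → ≤-refl
      (there (here refl)) → ≤-reflexive (sym level)

  Parent-unique : ∀ {x v p q} → Parent x v p → Parent x v q → p ≡ q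
  Parent-unique {x} {v} {p} {q} (v~p , p-level) (v~q , q-level) with p Fin.≟ q
  ... | yes p≡q = p≡q
  ... | no p≢q  = ⊥-elim (no-level-path (dist x p) x (p ∷⟨ adj-sym TG v~p ⟩ (v ∷⟨ v~q ⟩ [ q ])) p≢q refl
      (suc-injective (trans q-level (sym p-level)))
      (∉⇒Unique-∷ p∉ (∉⇒Unique-∷ (λ where (here v≡q) → ~-irrefl v~q v≡q) ([] ∷ [])))
      above)
    where
    p∉ : p ∉ v ∷ q ∷ []
    p∉ (here p≡v)         = ~-irrefl v~p (sym p≡v)
    p∉ (there (here p≡q)) = p≢q p≡q
    above : ∀ {z} → z ∈ p ∷ v ∷ q ∷ [] → dist x p ≤ dist x z
    above (here refl)                 = ≤-refl
    above (there (here refl))         = subst (dist x p ≤_) p-level (n≤1+n _)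
    above (there (there (here refl))) = ≤-reflexive (suc-injective (trans p-level (sym q-level)))

  ~⇒Parent⊎Parent : ∀ {x v y} → v ~ y → Parent x v y ⊎ Parent x y v
  ~⇒Parent⊎Parent {x} {v} {y} v~y with <-cmp (dist x y) (dist x v)
  ... | tri< y<v _ _ = inj₁ (v~y , ≤-antisym y<v (dist-step (adj-sym TG v~y)))
  ... | tri≈ _ y≡v _ = ⊥-elim (~⇒dist≢ v~y y≡v)
  ... | tri> _ _ v<y = inj₂ (adj-sym TG v~y , ≤-antisym v<y (dist-step v~y))

  non-parent : ∀ {x v y p} → v ~ y → Parent x v p → y ≢ p → Parent x y v
  non-parent v~y v-parent y≢p with ~⇒Parent⊎Parent v~y
  ... | inj₁ y-parent = ⊥-elim (y≢p (Parent-unique y-parent v-parent))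
  ... | inj₂ v-parent = v-parent

  distinct-parents⇒Between : ∀ {x₁ x₂ e p₁ p₂} → Parent x₁ e p₁ → Parent x₂ e p₂ → p₁ ≢ p₂ →
                             Between x₁ e x₂
  distinct-parents⇒Between = descend _ refl
    where
    -- Going from e towards x₂, the parent towards x₁ is always the vertex just left.
    descend : ∀ m {x₁ x₂ e p₁ p₂} → dist x₂ p₂ ≡ m → Parent x₁ e p₁ → Parent x₂ e p₂ → p₁ ≢ p₂ →
              Between x₁ e x₂
    descend m {x₁} {x₂} {e} {p₁} {p₂} p₂-level e-parent₁ (e~p₂ , e-level) p₁≢p₂ = begin
      dist x₁ e + dist e x₂         ≡⟨ cong (dist x₁ e +_) (trans (D-sym e x₂) (sym e-level)) ⟩
      dist x₁ e + suc (dist x₂ p₂)  ≡⟨ +-suc (dist x₁ e) (dist x₂ p₂) ⟩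
      suc (dist x₁ e) + dist x₂ p₂  ≡⟨ cong₂ _+_ p₂-level₁ (D-sym x₂ p₂) ⟩
      dist x₁ p₂ + dist p₂ x₂       ≡⟨ onwards m p₂-level ⟩
      dist x₁ x₂                    ∎
      where
      open ≡-Reasoning
      p₂-parent₁ : Parent x₁ p₂ e
      p₂-parent₁ = non-parent e~p₂ e-parent₁ (p₁≢p₂ ∘ sym)
      p₂-level₁ = proj₂ p₂-parent₁
      onwards : ∀ m → dist x₂ p₂ ≡ m → Between x₁ p₂ x₂
      onwards zero    p₂-level with refl ← D≡0⇒≡ p₂-level = Between-endʳ x₁ x₂
      onwards (suc m) p₂-level with p₃ , p₃-parent ← parent (λ where refl → 0≢1+n (trans (sym (D-refl x₂)) p₂-level)) =
        descend m (suc-injective (trans (proj₂ p₃-parent) p₂-level)) p₂-parent₁ p₃-parent e≢p₃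
        where
        e≢p₃ : e ≢ p₃
        e≢p₃ refl = 1+n≰n (≤-trans (n≤1+n _) (≤-reflexive (trans (cong suc (proj₂ p₃-parent)) e-level)))

  Between-median : ∀ {u v w e} → Between u v w → u ≢ v → w ≢ v → e ≢ v → Between e v u ⊎ Between e v w
  Between-median uvw u≢v w≢v e≢v
    with pu , u-parent ← parent u≢v | pw , w-parent ← parent w≢v | pe , e-parent ← parent e≢v
    with pe Fin.≟ pu
  ... | no pe≢pu = inj₁ (distinct-parents⇒Between e-parent u-parent pe≢pu)
  ... | yes refl = inj₂ (distinct-parents⇒Between e-parent w-parent
                     λ where refl → shared-parent⇒¬Between u-parent w-parent uvw)

  Between? : ∀ x y z → Dec (Between x y z)
  Between? x y z = dist x y + dist y z ℕ.≟ dist x z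

  -- l maximises dist p over the vertices behind e as seen from p; a second neighbour
  -- of l would lie behind e as well, and farther.
  far-leaf : ∀ {p e} → e ~ p → ∃ λ l → IsLeaf l × Between p e l
  far-leaf {p} {e} e~p = l , (r , l~r , r-unique) , Between-l
    where
    beyond = filter (Between? p e) (allFin n)
    l = argmax (dist p) e beyond
    Between-l : Between p e l
    Between-l = argmax-all (dist p) (Between-endʳ p e) (all-filter (Between? p e) (allFin n))
    farthest : ∀ {z} → Between p e z → dist p z ≤ dist p l
    farthest Bz = All.lookup (f[xs]≤f[argmax] e beyond) (∈-filter⁺ (Between? p e) (∈-allFin _) Bz)
    p≢l : p ≢ l
    p≢l p≡l = 0≢1+n (begin
      0                   ≡⟨ sym (D-refl p) ⟩
      dist p p            ≡⟨ cong (dist p) p≡l ⟩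
      dist p l            ≡⟨ sym Between-l ⟩
      dist p e + dist e l ≡⟨ cong (_+ dist e l) (~⇒dist≡1 (adj-sym TG e~p)) ⟩
      suc (dist e l)      ∎)
      where open ≡-Reasoning
    r = proj₁ (parent p≢l)
    l-parent = proj₂ (parent p≢l)
    l~r = proj₁ l-parent
    r-unique : ∀ {y} → l ~ y → y ≡ r
    r-unique {y} l~y with y Fin.≟ r
    ... | yes y≡r = y≡r
    ... | no y≢r  = ⊥-elim (1+n≰n (subst (_≤ dist p l) y-level (farthest Between-y)))
      where
      y-level : dist p y ≡ suc (dist p l)
      y-level = sym (proj₂ (non-parent l~y l-parent y≢r))
      Between-y : Between p e y
      Between-y = ≤-antisym (begin
        dist p e + dist e y        ≤⟨ +-monoʳ-≤ (dist p e) (dist-step l~y) ⟩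
        dist p e + suc (dist e l)  ≡⟨ +-suc (dist p e) (dist e l) ⟩
        suc (dist p e + dist e l)  ≡⟨ cong suc Between-l ⟩
        suc (dist p l)             ≡⟨ sym y-level ⟩
        dist p y                   ∎) (D-triangle p e y)
        where open ≤-Reasoning

  Between-beyond : ∀ {x e p l} → Parent x e p → Between p e l → Between x e l
  Between-beyond {x} {e} {p} {l} x-parent pel with l Fin.≟ e
  ... | yes refl = Between-endʳ x l
  ... | no l≢e with pl , l-parent ← parent l≢e = distinct-parents⇒Between x-parent l-parent p≢pl
    where
    p≢pl : p ≢ pl
    p≢pl refl = shared-parent⇒¬Between
      (proj₁ x-parent , trans (cong suc (D-refl p)) (sym (~⇒dist≡1 (adj-sym TG (proj₁ x-parent)))))
      l-parent pel

  Interior : List (Fin n) → Fin n → Set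
  Interior X e = ∃₂ λ a b → a ∈ X × b ∈ X × a ≢ e × b ≢ e × Between a e b

  interior? : ∀ X e → Dec (Interior X e)
  interior? X e = Dec.map′ found lose₂
    (Any.any? (λ a → Any.any? (λ b → ¬? (a Fin.≟ e) ×-dec ¬? (b Fin.≟ e) ×-dec Between? a e b) X) X)
    where
    Flanks : Fin n → Fin n → Set
    Flanks a b = a ≢ e × b ≢ e × Between a e b
    found : Any (λ a → Any (Flanks a) X) X → Interior X e
    found any-a with a , a∈ , any-b ← find any-a with b , b∈ , a≢e , b≢e , aeb ← find any-b =
      a , b , a∈ , b∈ , a≢e , b≢e , aeb
    lose₂ : Interior X e → Any (λ a → Any (Flanks a) X) X
    lose₂ (a , b , a∈ , b∈ , rest) = lose a∈ (lose b∈ rest)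

  leaf-not-interior : ∀ {X l} → IsLeaf l → ¬ Interior X l
  leaf-not-interior l-leaf (_ , _ , _ , _ , a≢l , b≢l , alb) = leaf-not-between l-leaf a≢l b≢l alb

  NoInterior : List (Fin n) → Set
  NoInterior X = ∀ {e} → e ∈ X → ¬ Interior X e

  leaf-beyond : ∀ {X e x₀} → NoInterior X → e ∈ X → x₀ ∈ X → x₀ ≢ e →
                ∃ λ l → IsLeaf l × (∀ {x} → x ∈ X → x ≢ e → Between x e l)
  leaf-beyond {X} {e} {x₀} none e∈ x₀∈ x₀≢e
    with p , x₀-parent ← parent x₀≢e
    with l , l-leaf , pel ← far-leaf (proj₁ x₀-parent) = l , l-leaf , beyond
    where
    beyond : ∀ {x} → x ∈ X → x ≢ e → Between x e l
    beyond {x} x∈ x≢e with px , x-parent ← parent x≢e | px Fin.≟ p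
    ... | yes refl = Between-beyond x-parent pel
    ... | no px≢p  = ⊥-elim (none e∈
          (x , x₀ , x∈ , x₀∈ , x≢e , x₀≢e , distinct-parents⇒Between x-parent x₀-parent px≢p))

  leaf-bound : ∀ {X Leaves} → Unique X → NoInterior X → (∀ {e} → e ∈ X → ∃ λ x₀ → x₀ ∈ X × x₀ ≢ e) →
               (∀ {l} → IsLeaf l → l ∈ Leaves) → length X ≤ length Leaves
  leaf-bound {X} !X none other leaf∈ =
    length-≤-by-injection !X (proj₁ ∘ beyond) (leaf∈ ∘ proj₁ ∘ proj₂ ∘ beyond) same-leaf
    where
    beyond : ∀ {e} → e ∈ X → ∃ λ l → IsLeaf l × (∀ {x} → x ∈ X → x ≢ e → Between x e l)
    beyond e∈ with x₀ , x₀∈ , x₀≢e ← other e∈ = leaf-beyond none e∈ x₀∈ x₀≢e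
    same-leaf : ∀ {e₁ e₂} (e₁∈ : e₁ ∈ X) (e₂∈ : e₂ ∈ X) → proj₁ (beyond e₁∈) ≡ proj₁ (beyond e₂∈) → e₁ ≡ e₂
    same-leaf {e₁} {e₂} e₁∈ e₂∈ same with e₁ Fin.≟ e₂
    ... | yes e₁≡e₂ = e₁≡e₂
    ... | no e₁≢e₂  = Between-antisym (proj₂ (proj₂ (beyond e₂∈)) e₁∈ e₁≢e₂)
                        (subst (Between _ _) same (proj₂ (proj₂ (beyond e₁∈)) e₂∈ (e₁≢e₂ ∘ sym)))

  two-leaves : ∀ {a b} → a ≢ b → 2 ≤ length leafList
  two-leaves {a} {b} a≢b = leaf-bound (∉⇒Unique-∷ a∉ ([] ∷ [])) none other IsLeaf⇒∈leafList
    where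
    a∉ : a ∉ b ∷ []
    a∉ (here a≡b) = a≢b a≡b
    other : ∀ {e} → e ∈ a ∷ b ∷ [] → ∃ λ x → x ∈ a ∷ b ∷ [] × x ≢ e
    other (here refl)         = b , there (here refl) , a≢b ∘ sym
    other (there (here refl)) = a , here refl , a≢b
    is-other : ∀ {e x} (e∈ : e ∈ a ∷ b ∷ []) → x ∈ a ∷ b ∷ [] → x ≢ e → x ≡ proj₁ (other e∈)
    is-other (here refl)         (here refl)         x≢e = ⊥-elim (x≢e refl)
    is-other (here refl)         (there (here refl)) _   = refl
    is-other (there (here refl)) (here refl)         _   = refl
    is-other (there (here refl)) (there (here refl)) x≢e = ⊥-elim (x≢e refl)
    none : NoInterior (a ∷ b ∷ [])
    none e∈ (x , y , x∈ , y∈ , x≢e , y≢e , xey)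
      with refl ← is-other e∈ x∈ x≢e | refl ← is-other e∈ y∈ y≢e =
      x≢e (D≡0⇒≡ (m+n≡0⇒m≡0 _ (trans xey (D-refl x))))

module Prism {n} (T : FinGraph n) (conn : Connected (toGraph T)) (acyc : ¬ HasCycle (toGraph T)) where

  open Tree T conn acyc public
  open WalkProperties TG

  P : Graph
  P = TG □ K₂

  Vertex : Set
  Vertex = Fin n × Fin 2

  pr : Vertex → Fin n
  pr = proj₁

  layer : Vertex → Fin 2
  layer = proj₂

  δ : Fin 2 → Fin 2 → ℕ
  δ 0F 0F = 0
  δ 0F 1F = 1
  δ 1F 0F = 1
  δ 1F 1F = 0

  δ-refl : ∀ i → δ i i ≡ 0
  δ-refl 0F = refl
  δ-refl 1F = refl

  δ-≢ : ∀ {i j} → i ≢ j → δ i j ≡ 1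
  δ-≢ {0F} {0F} i≢j = ⊥-elim (i≢j refl)
  δ-≢ {0F} {1F} _   = refl
  δ-≢ {1F} {0F} _   = refl
  δ-≢ {1F} {1F} i≢j = ⊥-elim (i≢j refl)

  δ-triangle : ∀ i j k → δ i k ≤ δ i j + δ j k
  δ-triangle 0F 0F k  = ≤-refl
  δ-triangle 1F 1F k  = ≤-refl
  δ-triangle 0F 1F 0F = z≤n
  δ-triangle 0F 1F 1F = ≤-refl
  δ-triangle 1F 0F 0F = ≤-refl
  δ-triangle 1F 0F 1F = z≤n

  δ-between : ∀ i j k → δ i j + δ j k ≡ δ i k → j ≡ i ⊎ j ≡ k
  δ-between 0F 0F _  _  = inj₁ refl
  δ-between 1F 1F _  _  = inj₁ refl
  δ-between 0F 1F 1F _  = inj₂ refl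
  δ-between 1F 0F 0F _  = inj₂ refl
  δ-between 0F 1F 0F ()
  δ-between 1F 0F 1F ()

  no-three-layers : ∀ {i j k : Fin 2} → i ≢ j → j ≢ k → i ≢ k → ⊥
  no-three-layers {0F} {0F} i≢j _ _ = i≢j refl
  no-three-layers {1F} {1F} i≢j _ _ = i≢j refl
  no-three-layers {0F} {1F} {0F} _ _ i≢k = i≢k refl
  no-three-layers {0F} {1F} {1F} _ j≢k _ = j≢k refl
  no-three-layers {1F} {0F} {0F} _ j≢k _ = j≢k refl
  no-three-layers {1F} {0F} {1F} _ _ i≢k = i≢k refl

  layer-cases : ∀ {i j} k → i ≢ j → k ≡ i ⊎ k ≡ j
  layer-cases {i} {j} k i≢j with k Fin.≟ i | k Fin.≟ j
  ... | yes k≡i | _       = inj₁ k≡i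
  ... | no _    | yes k≡j = inj₂ k≡j
  ... | no k≢i  | no k≢j  = ⊥-elim (no-three-layers i≢j (k≢j ∘ sym) (k≢i ∘ sym))

  D : Vertex → Vertex → ℕ
  D (x , i) (y , j) = dist x y + δ i j

  D-step : ∀ {a a′} b → Adj P a a′ → D a b ≤ suc (D a′ b)
  D-step {x , i} {x′ , .i} (y , j) (inj₁ (x~x′ , refl)) = +-monoˡ-≤ (δ i j) (dist-stepˡ x~x′)
  D-step {x , i} {.x , i′} (y , j) (inj₂ (refl , i≢i′)) =
    subst (dist x y + δ i j ≤_) (+-suc (dist x y) (δ i′ j)) (+-monoʳ-≤ (dist x y) (δ-step i j i≢i′))
    where
    δ-step : ∀ i j → i ≢ i′ → δ i j ≤ suc (δ i′ j)
    δ-step i j i≢i′ = ≤-trans (δ-triangle i i′ j) (≤-reflexive (cong (_+ δ i′ j) (δ-≢ i≢i′)))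

  D≤length : ∀ {a b} (p : Walk P a b) → D a b ≤ walkLength P p
  D≤length {x , i} [ _ ] = ≤-reflexive (cong₂ _+_ (D-refl x) (δ-refl i))
  D≤length {a} {b} (_ ∷⟨ a~a′ ⟩ p) = ≤-trans (D-step b a~a′) (s≤s (D≤length p))

  lift : ∀ i {x y} → Walk TG x y → Walk P (x , i) (y , i)
  lift i [ x ]          = [ (x , i) ]
  lift i (x ∷⟨ x~y ⟩ p) = (x , i) ∷⟨ inj₁ (x~y , refl) ⟩ lift i p

  length-lift : ∀ i {x y} (p : Walk TG x y) → walkLength P (lift i p) ≡ walkLength TG p
  length-lift i [ x ]        = refl
  length-lift i (x ∷⟨ _ ⟩ p) = cong suc (length-lift i p)

  D-geodesic : ∀ a b → Σ (Walk P a b) λ p → walkLength P p ≡ D a b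
  D-geodesic (x , i) (y , j) with p , p-geo ← dist-geodesic x y | i Fin.≟ j
  ... | yes refl = lift i p , (begin
    walkLength P (lift i p) ≡⟨ length-lift i p ⟩
    walkLength TG p         ≡⟨ p-geo ⟩
    dist x y                ≡⟨ +-identityʳ (dist x y) ⟨
    dist x y + 0            ≡⟨ cong (dist x y +_) (δ-refl i) ⟨
    dist x y + δ i i        ∎)
    where open ≡-Reasoning
  ... | no i≢j = (x , i) ∷⟨ inj₂ (refl , i≢j) ⟩ lift j p , (begin
    suc (walkLength P (lift j p)) ≡⟨ cong suc (trans (length-lift j p) p-geo) ⟩
    suc (dist x y)                ≡⟨ +-comm 1 (dist x y) ⟩
    dist x y + 1                  ≡⟨ cong (dist x y +_) (δ-≢ i≢j) ⟨
    dist x y + δ i j              ∎)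
    where open ≡-Reasoning

  open Geodesics P D D≤length D-geodesic
    using ()
    renaming (Between to Betweenᴾ; IsGPSet⇒NoneBetween to IsGPSet⇒NoneBetweenᴾ;
              NoneBetween⇒IsGPSet to NoneBetween⇒IsGPSetᴾ)

  Betweenᴾ⇒ : ∀ {x y z i j k} → Betweenᴾ (x , i) (y , j) (z , k) → Between x y z × (j ≡ i ⊎ j ≡ k)
  Betweenᴾ⇒ {x} {y} {z} {i} {j} {k} between
    with xyz , ijk ← +-squeeze (D-triangle x y z) (δ-triangle i j k)
                       (≤-reflexive (trans (interchange (dist x y) (dist y z) (δ i j) (δ j k)) between)) =
    xyz , δ-between i j k ijk

  ⇒Betweenᴾ : ∀ {x y z i j k} → Between x y z → j ≡ i ⊎ j ≡ k → Betweenᴾ (x , i) (y , j) (z , k)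
  ⇒Betweenᴾ {x} {y} {z} {i} {j} {k} xyz j≡i⊎j≡k =
    trans (interchange (dist x y) (δ i j) (dist y z) (δ j k)) (cong₂ _+_ xyz (δ-sum j≡i⊎j≡k))
    where
    δ-sum : j ≡ i ⊎ j ≡ k → δ i j + δ j k ≡ δ i k
    δ-sum (inj₁ refl) = cong (_+ δ j k) (δ-refl j)
    δ-sum (inj₂ refl) = trans (cong (δ i j +_) (δ-refl j)) (+-identityʳ (δ i j))

  _≟ᵛ_ : DecidableEquality Vertex
  _≟ᵛ_ = ≡-dec Fin._≟_ Fin._≟_

  InteriorIn : List Vertex → Vertex → Set
  InteriorIn C c = Interior (map pr C) (pr c)

  flanked⇒other-layer : ∀ {C a b c} → IsGPSet P C → a ∈ C → b ∈ C → c ∈ C → pr a ≢ pr c → pr b ≢ pr c →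
                        Between (pr a) (pr c) (pr b) → layer a ≢ layer c
  flanked⇒other-layer gp a∈ b∈ c∈ a≢c b≢c acb same-layer =
    IsGPSet⇒NoneBetweenᴾ gp a∈ c∈ b∈ (a≢c ∘ cong pr) (b≢c ∘ sym ∘ cong pr) a≢b (⇒Betweenᴾ acb (inj₁ (sym same-layer)))
    where
    a≢b : _
    a≢b refl = a≢c (D≡0⇒≡ (m+n≡0⇒m≡0 _ (trans acb (D-refl _))))

  Crowded : List Vertex → Set
  Crowded C = IsGPSet P C × length leafList < length C

  leaf-or-alone⇒IsGPSet : ∀ {C} → Unique (map pr C) →
    (∀ {c} → c ∈ C → IsLeaf (pr c) ⊎ (∀ {c′} → c′ ∈ C → c′ ≢ c → layer c′ ≢ layer c)) → IsGPSet P C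
  leaf-or-alone⇒IsGPSet {C} !prC leaf-or-alone = NoneBetween⇒IsGPSetᴾ (map⁻ !prC) none
    where
    pr-inj : ∀ {a b} → a ∈ C → b ∈ C → pr a ≡ pr b → a ≡ b
    pr-inj = Unique-map⁻-injective pr !prC
    none : ∀ {a b c} → a ∈ C → b ∈ C → c ∈ C → a ≢ b → b ≢ c → a ≢ c → ¬ Betweenᴾ a b c
    none a∈ b∈ c∈ a≢b b≢c _ abc with Betweenᴾ⇒ abc | leaf-or-alone b∈
    ... | between , _       | inj₁ b-leaf = leaf-not-between b-leaf (a≢b ∘ pr-inj a∈ b∈) (b≢c ∘ sym ∘ pr-inj c∈ b∈) between
    ... | _ , inj₁ b≡a      | inj₂ alone  = alone a∈ a≢b (sym b≡a)
    ... | _ , inj₂ b≡c      | inj₂ alone  = alone c∈ (b≢c ∘ sym) (sym b≡c)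

  legal-move : ∀ xs ys {u v} → Adj P u v → IsGPSet P (xs ++ v ∷ ys) → LegalMove P (xs ++ u ∷ ys) (xs ++ v ∷ ys)
  legal-move xs ys {u} {v} u~v gp′ = move xs ys u v u~v v∉ gp′
    where
    v∉ : v ∉ xs ++ u ∷ ys
    v∉ v∈ = proj₁ (Unique-insert⁻ xs (proj₁ gp′))
              (∈-insert⁻ xs v∈ λ v≡u → adj-irrefl P (subst (Adj P u) v≡u u~v))

  Moves : List Vertex → List Vertex → Set
  Moves = Star (LegalMove P)

  trail : ∀ {C C′} → Moves C C′ → List (List Vertex)
  trail ε                    = []
  trail (_◅_ {j = C₁} _ ms) = C₁ ∷ trail ms

  Moves⇒MoveSeq : ∀ {C C′} (ms : Moves C C′) → MoveSeq P (C ∷ trail ms)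
  Moves⇒MoveSeq {C} ε = done C
  Moves⇒MoveSeq (m ◅ ms) = step m (Moves⇒MoveSeq ms)

  module _ {Q : List Vertex → Set} where

    visits-target : ∀ {C C′} (ms : Moves C C′) → Q C′ → Any Q (C ∷ trail ms)
    visits-target ε        q = here q
    visits-target (_ ◅ ms) q = there (visits-target ms q)

    visits-◅◅ˡ : ∀ {C C′ C″} (ms : Moves C C′) (ns : Moves C′ C″) → Any Q (C ∷ trail ms) → Any Q (C ∷ trail (ms ◅◅ ns))
    visits-◅◅ˡ ε        _  (here q)  = here q
    visits-◅◅ˡ (_ ◅ ms) _  (here q)  = here q
    visits-◅◅ˡ (_ ◅ ms) ns (there v) = there (visits-◅◅ˡ ms ns v)

    visits-◅◅ʳ : ∀ {C C′ C″} (ms : Moves C C′) (ns : Moves C′ C″) → Any Q (C′ ∷ trail ns) → Any Q (C ∷ trail (ms ◅◅ ns))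
    visits-◅◅ʳ ε        _  v = v
    visits-◅◅ʳ (_ ◅ ms) ns v = there (visits-◅◅ʳ ms ns v)

  module UpperBound (ℓ≥2 : 2 ≤ length leafList) where

    crowded⇒3≤length : ∀ {C} → Crowded C → 3 ≤ length C
    crowded⇒3≤length (_ , large) = ≤-trans (s≤s ℓ≥2) large

    pr-injective : ∀ {C} → Crowded C → ∀ {a b} → a ∈ C → b ∈ C → pr a ≡ pr b → a ≡ b
    pr-injective {C} crowded@(gp , _) {x , i} {.x , j} a∈ b∈ refl with i Fin.≟ j
    ... | yes refl = refl
    ... | no i≢j with (y , k) , c∈ , c≢a , c≢b ← avoid-two _≟ᵛ_ (proj₁ gp) (crowded⇒3≤length crowded) (x , i) (x , j)
                 with layer-cases k i≢j
    ...   | inj₁ refl = ⊥-elim (IsGPSet⇒NoneBetweenᴾ gp b∈ a∈ c∈ (i≢j ∘ sym ∘ cong layer) (c≢a ∘ sym) (c≢b ∘ sym)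
                          (⇒Betweenᴾ (Between-endˡ x y) (inj₂ refl)))
    ...   | inj₂ refl = ⊥-elim (IsGPSet⇒NoneBetweenᴾ gp a∈ b∈ c∈ (i≢j ∘ cong layer) (c≢b ∘ sym) (c≢a ∘ sym)
                          (⇒Betweenᴾ (Between-endˡ x y) (inj₂ refl)))

    -- By the median property c lies between c′ and a or between c′ and b.
    interior-alone : ∀ {C c c′} → Crowded C → c ∈ C → InteriorIn C c → c′ ∈ C → c′ ≢ c → layer c′ ≢ layer c
    interior-alone crowded@(gp , _) c∈ (_ , _ , a′∈ , b′∈ , a′≢c , b′≢c , between) c′∈ c′≢c
      with a , a∈ , refl ← ∈-map⁻ pr a′∈ | b , b∈ , refl ← ∈-map⁻ pr b′∈
      with Between-median between a′≢c b′≢c (c′≢c ∘ pr-injective crowded c′∈ c∈)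
    ... | inj₁ c′ca = flanked⇒other-layer gp c′∈ a∈ c∈ (c′≢c ∘ pr-injective crowded c′∈ c∈) a′≢c c′ca
    ... | inj₂ c′cb = flanked⇒other-layer gp c′∈ b∈ c∈ (c′≢c ∘ pr-injective crowded c′∈ c∈) b′≢c c′cb

    interior-unique : ∀ {C c c′} → Crowded C → c ∈ C → InteriorIn C c → c′ ∈ C → InteriorIn C c′ → c ≡ c′
    interior-unique {c = c} {c′} crowded@(gp , _) c∈ c-int c′∈ c′-int with c ≟ᵛ c′
    ... | yes c≡c′ = c≡c′
    ... | no c≢c′ with r , r∈ , r≢c , r≢c′ ← avoid-two _≟ᵛ_ (proj₁ gp) (crowded⇒3≤length crowded) c c′ =
      ⊥-elim (no-three-layers (interior-alone crowded c∈ c-int r∈ r≢c)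
                              (interior-alone crowded c′∈ c′-int c∈ c≢c′)
                              (interior-alone crowded c′∈ c′-int r∈ r≢c′))

    exists-interior : ∀ {C} → Crowded C → ∃ λ c → c ∈ C × InteriorIn C c
    exists-interior {C} crowded@(gp , large) with Any.any? (λ c → interior? (map pr C) (pr c)) C
    ... | yes some = find some
    ... | no none  = ⊥-elim (<⇒≱ large (subst (_≤ length leafList) (length-map pr C)
          (leaf-bound (Unique-map⁺-injective pr (pr-injective crowded) (proj₁ gp)) no-interior other IsLeaf⇒∈leafList)))
      where
      no-interior : NoInterior (map pr C)
      no-interior e∈ with c , c∈ , refl ← ∈-map⁻ pr e∈ = none ∘ lose c∈
      other : ∀ {e} → e ∈ map pr C → ∃ λ x₀ → x₀ ∈ map pr C × x₀ ≢ e
      other e∈ with c , c∈ , refl ← ∈-map⁻ pr e∈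
               with c′ , c′∈ , c′≢c ← avoid-one _≟ᵛ_ (proj₁ gp) (≤-trans (n≤1+n 2) (crowded⇒3≤length crowded)) c =
        pr c′ , ∈-map⁺ pr c′∈ , c′≢c ∘ pr-injective crowded c′∈ c∈

    InteriorOnLayer : Fin 2 → List Vertex → Set
    InteriorOnLayer b C = ∃ λ c → c ∈ C × InteriorIn C c × layer c ≡ b

    move-preserves-crowded : ∀ {C C′} → Crowded C → LegalMove P C C′ → Crowded C′
    move-preserves-crowded (_ , large) (move xs ys u v _ _ gp′) =
      gp′ , subst (length leafList <_) (trans (length-insert xs) (sym (length-insert xs))) large

    -- If the layers differed, a robot other than c₀ and c₁ that does not move would lie in
    -- neither layer.  As at least two robots do not move, neither do c₀ and c₁; then a
    -- horizontal move leaves the mover in neither layer, and a vertical one keeps all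
    -- projections, making c₁ interior before the move as well.
    move-keeps-interior-layer : ∀ xs ys {u v c₀ c₁} → Crowded (xs ++ u ∷ ys) → Adj P u v →
      v ∉ xs ++ u ∷ ys → Crowded (xs ++ v ∷ ys) →
      c₀ ∈ xs ++ u ∷ ys → InteriorIn (xs ++ u ∷ ys) c₀ →
      c₁ ∈ xs ++ v ∷ ys → InteriorIn (xs ++ v ∷ ys) c₁ → layer c₁ ≡ layer c₀
    move-keeps-interior-layer xs ys {u} {v} {c₀} {c₁} crowded u~v v∉C crowded′ c₀∈ c₀-int c₁∈ c₁-int =
      decidable-stable (layer c₁ Fin.≟ layer c₀) λ differ → cases differ (c₀ ≟ᵛ u) (c₁ ≟ᵛ v)
      where
      !R : Unique (xs ++ ys)
      !R = proj₂ (Unique-insert⁻ xs (proj₁ (proj₁ crowded)))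
      u∉R : u ∉ xs ++ ys
      u∉R = proj₁ (Unique-insert⁻ xs (proj₁ (proj₁ crowded)))
      v∉R : v ∉ xs ++ ys
      v∉R = v∉C ∘ ∈-insert⁺ xs
      2≤R : 2 ≤ length (xs ++ ys)
      2≤R = ≤-pred (subst (3 ≤_) (length-insert xs) (crowded⇒3≤length crowded))
      clash : layer c₁ ≢ layer c₀ → ∀ {r} → r ∈ xs ++ ys → r ≢ c₀ → r ≢ c₁ → ⊥
      clash differ r∈ r≢c₀ r≢c₁ = no-three-layers
        (interior-alone crowded c₀∈ c₀-int (∈-insert⁺ xs r∈) r≢c₀) (differ ∘ sym)
        (interior-alone crowded′ c₁∈ c₁-int (∈-insert⁺ xs r∈) r≢c₁)
      both-stay : layer c₁ ≢ layer c₀ → c₀ ≢ u → c₁ ≢ v → Adj P u v → ⊥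
      both-stay differ c₀≢u c₁≢v (inj₁ (_ , same-layer)) = no-three-layers
        (interior-alone crowded c₀∈ c₀-int (∈-insert xs) (c₀≢u ∘ sym))
        (differ ∘ sym)
        (subst (_≢ layer c₁) (sym same-layer) (interior-alone crowded′ c₁∈ c₁-int (∈-insert xs) (c₁≢v ∘ sym)))
      both-stay differ c₀≢u c₁≢v (inj₂ (same-pr , _)) = differ (cong layer (sym
        (interior-unique crowded c₀∈ c₀-int (∈-insert⁺ xs (∈-insert⁻ xs c₁∈ c₁≢v))
          (subst (λ X → Interior X (pr c₁)) (sym (map-insert pr xs same-pr)) c₁-int))))
      cases : layer c₁ ≢ layer c₀ → Dec (c₀ ≡ u) → Dec (c₁ ≡ v) → ⊥
      cases differ (yes c₀≡u) _
        with r , r∈ , r≢c₁ ← avoid-one _≟ᵛ_ !R 2≤R c₁ =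
        clash differ r∈ (λ r≡c₀ → u∉R (subst (_∈ xs ++ ys) (trans r≡c₀ c₀≡u) r∈)) r≢c₁
      cases differ (no _) (yes c₁≡v)
        with r , r∈ , r≢c₀ ← avoid-one _≟ᵛ_ !R 2≤R c₀ =
        clash differ r∈ r≢c₀ (λ r≡c₁ → v∉R (subst (_∈ xs ++ ys) (trans r≡c₁ c₁≡v) r∈))
      cases differ (no c₀≢u) (no c₁≢v) = both-stay differ c₀≢u c₁≢v u~v

    move-preserves-interior-layer : ∀ {b C C′} → Crowded C → LegalMove P C C′ →
                                    InteriorOnLayer b C → InteriorOnLayer b C′
    move-preserves-interior-layer crowded m@(move xs ys u v u~v v∉C _) (c₀ , c₀∈ , c₀-int , refl)
      with c₁ , c₁∈ , c₁-int ← exists-interior (move-preserves-crowded crowded m) =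
      c₁ , c₁∈ , c₁-int ,
      move-keeps-interior-layer xs ys crowded u~v v∉C (move-preserves-crowded crowded m) c₀∈ c₀-int c₁∈ c₁-int

    some-leaf : ∃ IsLeaf
    some-leaf = _ , ∈leafList⇒IsLeaf (∈-lookup (Fin.fromℕ< (≤-trans (s≤s z≤n) ℓ≥2)))

    along-moves : ∀ {b C cs} → MoveSeq P (C ∷ cs) → Crowded C → InteriorOnLayer b C →
                  ∀ {E} → E ∈ C ∷ cs → Crowded E × InteriorOnLayer b E
    along-moves _              crowded on-b (here refl) = crowded , on-b
    along-moves (step m moves) crowded on-b (there E∈)  =
      along-moves moves (move-preserves-crowded crowded m) (move-preserves-interior-layer crowded m on-b) E∈

    mobile-bound : ∀ S → IsMobileGPSet P S → length S ≤ length leafList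
    mobile-bound S (gp , cs , moves , covers) with length S ≤? length leafList
    ... | yes bounded = bounded
    ... | no unbounded
      with l , l-leaf ← some-leaf
      with crowded ← (gp , ≰⇒> unbounded)
      with c₀ , c₀∈ , c₀-int ← exists-interior crowded
      with E , E∈ , l∈E ← find (covers (l , layer c₀))
      with crowdedᴱ , c , c∈ , c-int , c-layer ← along-moves moves crowded (c₀ , c₀∈ , c₀-int , refl) E∈
      with (l , layer c₀) ≟ᵛ c
    ...   | yes refl = ⊥-elim (leaf-not-interior l-leaf c-int)
    ...   | no l≢c   = ⊥-elim (interior-alone crowdedᴱ c∈ c-int l∈E l≢c (sym c-layer))

  on : Fin 2 → List (Fin n) → List Vertex
  on i = map (_, i)

  pr-on : ∀ i xs → map pr (on i xs) ≡ xs
  pr-on i xs = trans (sym (map-∘ xs)) (map-id xs)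

  module LowerBound (x₁ : Fin n) (R : List (Fin n)) (!L : Unique (x₁ ∷ R))
                    (L-leaves : ∀ {z} → z ∈ x₁ ∷ R → IsLeaf z) where

    x₁∉R : x₁ ∉ R
    x₁∉R = Unique[x∷xs]⇒x∉xs !L

    !R : Unique R
    !R = proj₂ (Unique-insert⁻ [] !L)

    all-leaves⇒IsGPSet : ∀ {C} → map pr C ≡ x₁ ∷ R → IsGPSet P C
    all-leaves⇒IsGPSet {C} prC≡L = leaf-or-alone⇒IsGPSet (subst Unique (sym prC≡L) !L)
      λ {c} c∈ → inj₁ (L-leaves (subst (pr c ∈_) prC≡L (∈-map⁺ pr c∈)))

    walker-IsGPSet : ∀ {i j w} → i ≢ j → w ∉ R → IsGPSet P ((w , i) ∷ on j R)
    walker-IsGPSet {i} {j} {w} i≢j w∉R =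
      leaf-or-alone⇒IsGPSet (subst Unique (sym (cong (w ∷_) (pr-on j R))) (∉⇒Unique-∷ w∉R !R)) λ where
        (here refl) → inj₂ λ where
          (here refl) c≢c → ⊥-elim (c≢c refl)
          (there c′∈) _   → λ layer≡i → i≢j (trans (sym layer≡i) (layer-on c′∈))
        (there c∈) → inj₁ (L-leaves (there (pr-on∈ c∈)))
      where
      layer-on : ∀ {c} → c ∈ on j R → layer c ≡ j
      layer-on c∈ with _ , _ , refl ← ∈-map⁻ (_, j) c∈ = refl
      pr-on∈ : ∀ {c} → c ∈ on j R → pr c ∈ R
      pr-on∈ c∈ with _ , z∈ , refl ← ∈-map⁻ (_, j) c∈ = z∈

    walk-along : ∀ {i j} → i ≢ j → ∀ {a c} (p : Walk TG a c) → (∀ {z} → z ∈ verts TG p → z ∉ R) →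
           Σ (Moves ((a , i) ∷ on j R) ((c , i) ∷ on j R)) λ ms →
             ∀ {z} → z ∈ verts TG p → Any ((z , i) ∈_) (((a , i) ∷ on j R) ∷ trail ms)
    walk-along i≢j [ a ] _ = ε , λ where (here refl) → here (here refl)
    walk-along i≢j (a ∷⟨ a~b ⟩ p) avoids with ms , visits ← walk-along i≢j p (avoids ∘ there) =
      legal-move [] _ (inj₁ (a~b , refl)) (walker-IsGPSet i≢j (avoids (there (source∈verts p)))) ◅ ms ,
      λ where
        (here refl) → here (here refl)
        (there z∈)  → there (visits z∈)

    geodesic-avoids-R : ∀ {a c} (p : Walk TG a c) → IsGeodesic p → a ∉ R → c ∉ R → ∀ {z} → z ∈ verts TG p → z ∉ R
    geodesic-avoids-R p p-geo a∉R c∉R z∈p z∈R =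
      leaf-not-between (L-leaves (there z∈R)) (λ where refl → a∉R z∈R) (λ where refl → c∉R z∈R)
        (∈-geodesic⇒Between p-geo z∈p)

    sweep : ∀ zs → Σ (Walk TG x₁ x₁) λ p →
            (∀ {z} → z ∈ zs → z ∉ R → z ∈ verts TG p) × (∀ {z} → z ∈ verts TG p → z ∉ R)
    sweep [] = [ x₁ ] , (λ ()) , λ where (here refl) → x₁∉R
    sweep (z ∷ zs) with sweep zs | Any.any? (z Fin.≟_) R
    ... | p , covers , avoids | yes z∈R = p , (λ where (here refl) z∉R → ⊥-elim (z∉R z∈R)
                                                       (there z∈) → covers z∈) , avoids
    ... | p , covers , avoids | no z∉R
      with out , out-geo ← dist-geodesic x₁ z | back , back-geo ← dist-geodesic z x₁ =
      (out ++ᵂ back) ++ᵂ p , covers′ , avoids′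
      where
      covers′ : ∀ {w} → w ∈ z ∷ zs → w ∉ R → w ∈ verts TG ((out ++ᵂ back) ++ᵂ p)
      covers′ (here refl) _ = ∈-++ᵂ⁺ˡ (out ++ᵂ back) p (∈-++ᵂ⁺ˡ out back (target∈verts out))
      covers′ (there w∈) w∉R = ∈-++ᵂ⁺ʳ (out ++ᵂ back) p (covers w∈ w∉R)
      avoids′ : ∀ {w} → w ∈ verts TG ((out ++ᵂ back) ++ᵂ p) → w ∉ R
      avoids′ w∈ with ∈-++ᵂ⁻ (out ++ᵂ back) p w∈
      ... | inj₂ w∈p = avoids w∈p
      ... | inj₁ w∈out++back with ∈-++ᵂ⁻ out back w∈out++back
      ...   | inj₁ w∈out  = geodesic-avoids-R out out-geo x₁∉R z∉R w∈out
      ...   | inj₂ w∈back = geodesic-avoids-R back back-geo z∉R x₁∉R w∈back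

    switch-layers : ∀ {i j} → i ≢ j → ∀ pre Q → map pr pre ++ Q ≡ x₁ ∷ R → Moves (pre ++ on i Q) (pre ++ on j Q)
    switch-layers i≢j pre []      _       = ε
    switch-layers {i} {j} i≢j pre (q ∷ Q) prs≡L =
      legal-move pre (on i Q) (inj₂ (refl , i≢j)) (all-leaves⇒IsGPSet (begin
        map pr (pre ++ (q , j) ∷ on i Q)     ≡⟨ map-++ pr pre _ ⟩
        map pr pre ++ q ∷ map pr (on i Q)    ≡⟨ cong (λ qs → map pr pre ++ q ∷ qs) (pr-on i Q) ⟩
        map pr pre ++ q ∷ Q                  ≡⟨ prs≡L ⟩
        x₁ ∷ R                               ∎)) ◅
      subst₂ Moves (∷ʳ-++ pre (q , j) (on i Q)) (∷ʳ-++ pre (q , j) (on j Q))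
        (switch-layers i≢j (pre ∷ʳ (q , j)) Q (begin
          map pr (pre ∷ʳ (q , j)) ++ Q       ≡⟨ cong (_++ Q) (map-++ pr pre _) ⟩
          (map pr pre ∷ʳ q) ++ Q             ≡⟨ ∷ʳ-++ (map pr pre) q Q ⟩
          map pr pre ++ q ∷ Q                ≡⟨ prs≡L ⟩
          x₁ ∷ R                             ∎))
      where open ≡-Reasoning

    mobile-set : ∃ λ S → IsMobileGPSet P S × length S ≡ length (x₁ ∷ R)
    mobile-set with path , covers , avoids ← sweep (allFin n) =
      S , (all-leaves⇒IsGPSet (cong (x₁ ∷_) (pr-on 1F R)) , trail tour , Moves⇒MoveSeq tour , visits) ,
      cong suc (length-map _ R)
      where
      S = (x₁ , 0F) ∷ on 1F R
      lower-walk = walk-along {0F} {1F} (λ ()) path avoids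
      raise-x₁ : LegalMove P S ((x₁ , 1F) ∷ on 1F R)
      raise-x₁ = legal-move [] (on 1F R) (inj₂ (refl , λ ())) (all-leaves⇒IsGPSet (cong (x₁ ∷_) (pr-on 1F R)))
      lower-others : Moves ((x₁ , 1F) ∷ on 1F R) ((x₁ , 1F) ∷ on 0F R)
      lower-others = switch-layers (λ ()) ((x₁ , 1F) ∷ []) R refl
      upper-walk = walk-along {1F} {0F} (λ ()) path avoids
      tour : Moves S ((x₁ , 1F) ∷ on 0F R)
      tour = proj₁ lower-walk ◅◅ (raise-x₁ ◅ (lower-others ◅◅ proj₁ upper-walk))
      visits : ∀ v → Any (v ∈_) (S ∷ trail tour)
      visits (z , k) with Any.any? (z Fin.≟_) R | k
      ... | yes z∈R | 1F = here (there (∈-map⁺ (_, 1F) z∈R))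
      ... | yes z∈R | 0F = visits-◅◅ʳ (proj₁ lower-walk) _ (there (visits-◅◅ˡ lower-others _
                             (visits-target lower-others (there (∈-map⁺ (_, 0F) z∈R)))))
      ... | no z∉R  | 0F = visits-◅◅ˡ (proj₁ lower-walk) _ (proj₂ lower-walk (covers (∈-allFin z) z∉R))
      ... | no z∉R  | 1F = visits-◅◅ʳ (proj₁ lower-walk) _ (there (visits-◅◅ʳ lower-others _
                             (proj₂ upper-walk (covers (∈-allFin z) z∉R))))

  mobile-set : 1 ≤ length leafList → ∃ λ S → IsMobileGPSet P S × length S ≡ length leafList
  mobile-set = from-leaves leafList Unique-leafList ∈leafList⇒IsLeaf
    where
    from-leaves : ∀ L → Unique L → (∀ {z} → z ∈ L → IsLeaf z) → 1 ≤ length L →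
                  ∃ λ S → IsMobileGPSet P S × length S ≡ length L
    from-leaves (x₁ ∷ R) !L L-leaves _ = LowerBound.mobile-set x₁ R !L L-leaves

theorem3p1 : ∀ (n : ℕ) (T : FinGraph n) → 3 ≤ n → IsTree T →
    MobIs (toGraph T □ K₂) (leaves T)
theorem3p1 _ T (s≤s (s≤s _)) (conn , acyc) = mobile-set (≤-trans (s≤s z≤n) ℓ≥2) , UpperBound.mobile-bound ℓ≥2
  where
  open Prism T conn acyc
  ℓ≥2 : 2 ≤ length leafList
  ℓ≥2 = two-leaves {0F} {1F} λ ()
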